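{- Fix an integer $k \geq 3$. Let $f_0(x), f_1(x), \ldots$ be a sequence of polynomials satisfying $$f_n(x) = x \sum_{j=1}^k f_{n-j}(x)$$ for all $n \geq k$. For $n \geq 0$ let $\mathcal{P}_n$ be the property that (i) the coefficient sequence of $f_i$ is non-negative and unimodal for each $0 \leq i \leq n$, and (ii) there is a choice of modes $m_i$ of $f_i$ ($0 \leq i \leq n$) such that the sequence $(m_i)_{i=0}^n$ is barely increasing. If $\mathcal{P}_k$ holds, then $\mathcal{P}_n$ holds for all $n \geq k$.
   Context: A sequence $(a_c)_{c\geq 0}$ is unimodal if there is an index $m$ (a mode) with $a_0 \leq a_1 \leq \cdots \leq a_m \geq a_{m+1} \geq a_{m+2} \geq \cdots$; modes need not be unique. A polynomial is unimodal if its coefficient sequence $(a_c)_{c \geq 0}$ (where $a_c$ is the coefficient of $x^c$) is unimodal, and a mode of the polynomial is a mode of this sequence. A sequence $(m_i)_{i=c}^d$ is barely increasing if $0 \leq m_{i+1}-m_i \leq 1$ for all $c \leq i \leq d-1$.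
   Formalization: The polynomials fₙ have rational coefficients. -}

module Defs where

open import Data.Nat as ℕ using (ℕ; zero; suc; _∸_)
open import Data.Rational using (ℚ; 0ℚ; _+_; _≤_)
open import Data.Product using (_×_; ∃)
open import Relation.Binary.PropositionalEquality using (_≡_)

-- A polynomial is represented by its coefficient sequence  a : ℕ → ℚ
-- (a c = coefficient of x^c), together with a finite-support condition.
Coeffs : Set
Coeffs = ℕ → ℚ

IsPolynomial : Coeffs → Set
IsPolynomial a = ∃ λ D → ∀ c → D ℕ.< c → a c ≡ 0ℚ

Σ₁ : ℕ → (ℕ → ℚ) → ℚ
Σ₁ zero    g = 0ℚ
Σ₁ (suc k) g = Σ₁ k g + g (suc k)

IsMode : Coeffs → ℕ → Set
IsMode a m = (∀ c → c ℕ.< m → a c ≤ a (suc c)) × (∀ c → m ℕ.≤ c → a (suc c) ≤ a c)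

Unimodal : Coeffs → Set
Unimodal a = ∃ λ m → IsMode a m

NonNeg : Coeffs → Set
NonNeg a = ∀ c → 0ℚ ≤ a c

-- f_n(x) = x · Σ_{j=1}^k f_{n-j}(x) for all n ≥ k, coefficientwise:
-- [x^0] f_n = 0 and [x^{c+1}] f_n = Σ_{j=1}^k [x^c] f_{n-j}
Recurrence : ℕ → (ℕ → Coeffs) → Set
Recurrence k f = ∀ n → k ℕ.≤ n →
  (f n 0 ≡ 0ℚ) × (∀ c → f n (suc c) ≡ Σ₁ k (λ j → f (n ∸ j) c))

BarelyIncreasing : ℕ → (ℕ → ℕ) → Set
BarelyIncreasing n m = ∀ i → i ℕ.< n → (m i ℕ.≤ m (suc i)) × (m (suc i) ℕ.≤ suc (m i))

P : (ℕ → Coeffs) → ℕ → Set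
P f n =
  (∀ i → i ℕ.≤ n → NonNeg (f i) × Unimodal (f i)) ×
  (∃ λ (m : ℕ → ℕ) → (∀ i → i ℕ.≤ n → IsMode (f i) (m i)) × BarelyIncreasing n m)

{-# OPTIONS --safe #-}
module Submission where

-- Subtracting the recurrence at n from the one at n + 1 gives
--   f_{n+1} = x f_n + f_n − x f_{n−k},
-- i.e. [x^{e+1}] f_{n+1} + [x^e] f_{n−k} = [x^e] f_n + [x^{e+1}] f_n.
-- With M a mode of f_n, we show that f_{n+1} rises up to M and falls from M + 1 on, so M or
-- M + 1 is a mode of f_{n+1}.  Falling from M + 1 on and rising below the mode of f_{n−k}
-- are inherited termwise from the recurrence, since the modes of f_{n−k}, …, f_n increase
-- from that of f_{n−k} to M.  Between the mode of f_{n−k} and M, f_{n−k} is falling, so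
-- the identity above transfers the rise of f_n to f_{n+1}.

open import Defs
open import Data.Nat using (ℕ; zero; suc; _∸_; _<_; _≤_; s≤s; _≤′_; ≤′-refl; ≤′-step)
import Data.Nat as ℕ
import Data.Nat.Properties as ℕ
open import Data.Rational as ℚ using (ℚ; 0ℚ; _+_)
import Data.Rational.Properties as ℚ
open import Data.Product using (_×_; _,_; proj₁; proj₂; ∃)
open import Data.Sum using (inj₁; inj₂)
open import Data.Empty using (⊥-elim)
open import Relation.Nullary using (yes; no)
open import Relation.Binary.PropositionalEquality
  using (_≡_; refl; sym; trans; cong; subst; subst₂; module ≡-Reasoning)

Σ₁-peel : ∀ k (g : ℕ → ℚ) → Σ₁ (suc k) g ≡ g 1 + Σ₁ k (λ j → g (suc j))
Σ₁-peel zero    g = trans (ℚ.+-identityˡ (g 1)) (sym (ℚ.+-identityʳ (g 1)))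
Σ₁-peel (suc k) g = trans (cong (_+ g (suc (suc k))) (Σ₁-peel k g)) (ℚ.+-assoc (g 1) _ _)

Σ₁-mono-≤ : ∀ k {g h : ℕ → ℚ} → (∀ j → j < k → g (suc j) ℚ.≤ h (suc j)) → Σ₁ k g ℚ.≤ Σ₁ k h
Σ₁-mono-≤ zero    g≤h = ℚ.≤-refl
Σ₁-mono-≤ (suc k) g≤h =
  ℚ.+-mono-≤ (Σ₁-mono-≤ k (λ j j<k → g≤h j (ℕ.m<n⇒m<1+n j<k))) (g≤h k ℕ.≤-refl)

Σ₁-nonNeg : ∀ k {g : ℕ → ℚ} → (∀ j → j < k → 0ℚ ℚ.≤ g (suc j)) → 0ℚ ℚ.≤ Σ₁ k g
Σ₁-nonNeg k {g} 0≤g = subst (ℚ._≤ Σ₁ k g) (Σ₁-zero k) (Σ₁-mono-≤ k 0≤g)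
  where
  Σ₁-zero : ∀ k → Σ₁ k (λ _ → 0ℚ) ≡ 0ℚ
  Σ₁-zero zero    = refl
  Σ₁-zero (suc k) = cong (_+ 0ℚ) (Σ₁-zero k)

+-cancelʳ-≤ : ∀ a {p q : ℚ} → p + a ℚ.≤ q + a → p ℚ.≤ q
+-cancelʳ-≤ a {p} {q} p+a≤q+a with p ℚ.≤? q
... | yes p≤q = p≤q
... | no  p≰q = ⊥-elim (ℚ.<-irrefl refl
  (ℚ.<-≤-trans (ℚ.+-mono-<-≤ (ℚ.≰⇒> p≰q) (ℚ.≤-refl {a})) p+a≤q+a))

RisesBelow : Coeffs → ℕ → Set
RisesBelow a m = ∀ c → c < m → a c ℚ.≤ a (suc c)

FallsFrom : Coeffs → ℕ → Set
FallsFrom a m = ∀ c → m ≤ c → a (suc c) ℚ.≤ a c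

rises∧falls⇒mode : ∀ {a M} → RisesBelow a M → FallsFrom a (suc M) →
                   ∃ λ μ → IsMode a μ × M ≤ μ × μ ≤ suc M
rises∧falls⇒mode {a} {M} rises falls with a (suc M) ℚ.≤? a M
... | yes fallsAtM = M , (rises , fallsFromM) , ℕ.≤-refl , ℕ.n≤1+n M
  where
  fallsFromM : FallsFrom a M
  fallsFromM c M≤c with ℕ.m≤n⇒m<n∨m≡n M≤c
  ... | inj₁ M<c  = falls c M<c
  ... | inj₂ refl = fallsAtM
... | no  risesAtM = suc M , (risesBelow1+M , falls) , ℕ.n≤1+n M , ℕ.≤-refl
  where
  risesBelow1+M : RisesBelow a (suc M)
  risesBelow1+M c (s≤s c≤M) with ℕ.m≤n⇒m<n∨m≡n c≤M
  ... | inj₁ c<M  = rises c c<M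
  ... | inj₂ refl = ℚ.<⇒≤ (ℚ.≰⇒> risesAtM)

barelyIncreasing⇒mono : ∀ {n m a b} → BarelyIncreasing n m → a ≤′ b → b ≤ n → m a ≤ m b
barelyIncreasing⇒mono bi ≤′-refl         _   = ℕ.≤-refl
barelyIncreasing⇒mono bi (≤′-step a≤′b) b<n =
  ℕ.≤-trans (barelyIncreasing⇒mono bi a≤′b (ℕ.<⇒≤ b<n)) (proj₁ (bi _ b<n))

extend : (ℕ → ℕ) → ℕ → ℕ → ℕ → ℕ
extend m n μ i with i ℕ.≤? n
... | yes _ = m i
... | no  _ = μ

extend-≤ : ∀ m {n} μ {i} → i ≤ n → extend m n μ i ≡ m i
extend-≤ m {n} μ {i} i≤n with i ℕ.≤? n
... | yes _   = refl
... | no  i≰n = ⊥-elim (i≰n i≤n)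

extend-suc : ∀ m n μ → extend m n μ (suc n) ≡ μ
extend-suc m n μ with suc n ℕ.≤? n
... | yes 1+n≤n = ⊥-elim (ℕ.1+n≰n 1+n≤n)
... | no  _     = refl

P-extend : ∀ {f n m μ} → (∀ i → i ≤ n → NonNeg (f i)) → NonNeg (f (suc n)) →
           (∀ i → i ≤ n → IsMode (f i) (m i)) → BarelyIncreasing n m →
           IsMode (f (suc n)) μ → m n ≤ μ → μ ≤ suc (m n) → P f (suc n)
P-extend {f} {n} {m} {μ} nonNeg nonNegN modes bi modeN m≤μ μ≤1+m =
  nonNeg∧unimodal , extend m n μ , modes′ , bi′
  where
  nonNeg∧unimodal : ∀ i → i ≤ suc n → NonNeg (f i) × Unimodal (f i)
  nonNeg∧unimodal i i≤1+n with ℕ.m≤n⇒m<n∨m≡n i≤1+n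
  ... | inj₁ (s≤s i≤n) = nonNeg i i≤n , m i , modes i i≤n
  ... | inj₂ refl      = nonNegN , μ , modeN

  modes′ : ∀ i → i ≤ suc n → IsMode (f i) (extend m n μ i)
  modes′ i i≤1+n with ℕ.m≤n⇒m<n∨m≡n i≤1+n
  ... | inj₁ (s≤s i≤n) = subst (IsMode (f i)) (sym (extend-≤ m μ i≤n)) (modes i i≤n)
  ... | inj₂ refl      = subst (IsMode (f (suc n))) (sym (extend-suc m n μ)) modeN

  bi′ : BarelyIncreasing (suc n) (extend m n μ)
  bi′ i (s≤s i≤n) with ℕ.m≤n⇒m<n∨m≡n i≤n
  ... | inj₁ i<n
    rewrite extend-≤ m μ (ℕ.<⇒≤ i<n) | extend-≤ m μ i<n = bi i i<n
  ... | inj₂ refl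
    rewrite extend-≤ m μ (ℕ.≤-refl {n}) | extend-suc m n μ = m≤μ , μ≤1+m

-- Here k is one less than the order of the recurrence: f (n ∸ suc k) is f_{n−k} above.
module _ {k : ℕ} {f : ℕ → Coeffs} (rec : Recurrence (suc k) f) where

  shift-identity : ∀ {n} → suc k ≤ n → ∀ e →
                   f (suc n) (suc e) + f (n ∸ suc k) e ≡ f n e + f n (suc e)
  shift-identity {n} k<n e = begin
    f (suc n) (suc e) + f (n ∸ suc k) e
      ≡⟨ cong (_+ f (n ∸ suc k) e) (trans (proj₂ (rec (suc n) (ℕ.m≤n⇒m≤1+n k<n)) e)
                                          (Σ₁-peel k _)) ⟩
    (f n e + middle) + f (n ∸ suc k) e
      ≡⟨ ℚ.+-assoc (f n e) middle _ ⟩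
    f n e + (middle + f (n ∸ suc k) e)
      ≡⟨ cong (f n e +_) (sym (proj₂ (rec n k<n) e)) ⟩
    f n e + f n (suc e) ∎
    where
    open ≡-Reasoning
    middle : ℚ
    middle = Σ₁ k (λ j → f (n ∸ j) e)

  module _ {n m} (k<n : suc k ≤ n) (nonNeg : ∀ i → i ≤ n → NonNeg (f i))
           (modes : ∀ i → i ≤ n → IsMode (f i) (m i)) (bi : BarelyIncreasing n m) where

    private
      rec′ : (f (suc n) 0 ≡ 0ℚ) × (∀ c → f (suc n) (suc c) ≡ Σ₁ (suc k) (λ j → f (suc n ∸ j) c))
      rec′ = rec (suc n) (ℕ.m≤n⇒m≤1+n k<n)

      n∸j≤n : ∀ j → n ∸ j ≤ n
      n∸j≤n = ℕ.m∸n≤m n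

      mode-n∸1+k≤mode-n∸j : ∀ j → j ≤ suc k → m (n ∸ suc k) ≤ m (n ∸ j)
      mode-n∸1+k≤mode-n∸j j j≤1+k =
        barelyIncreasing⇒mono bi (ℕ.≤⇒≤′ (ℕ.∸-monoʳ-≤ n j≤1+k)) (n∸j≤n j)

      mode-n∸j≤mode-n : ∀ j → m (n ∸ j) ≤ m n
      mode-n∸j≤mode-n j = barelyIncreasing⇒mono bi (ℕ.≤⇒≤′ (n∸j≤n j)) ℕ.≤-refl

    next-nonNeg : NonNeg (f (suc n))
    next-nonNeg zero    = subst (0ℚ ℚ.≤_) (sym (proj₁ rec′)) ℚ.≤-refl
    next-nonNeg (suc c) = subst (0ℚ ℚ.≤_) (sym (proj₂ rec′ c))
      (Σ₁-nonNeg (suc k) (λ j _ → nonNeg (n ∸ j) (n∸j≤n j) c))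

    next-rises-early : ∀ d → d < m (n ∸ suc k) → f (suc n) (suc d) ℚ.≤ f (suc n) (suc (suc d))
    next-rises-early d d<m₀ = subst₂ ℚ._≤_ (sym (proj₂ rec′ d)) (sym (proj₂ rec′ (suc d)))
      (Σ₁-mono-≤ (suc k) (λ j j<1+k →
        proj₁ (modes (n ∸ j) (n∸j≤n j)) d (ℕ.<-≤-trans d<m₀ (mode-n∸1+k≤mode-n∸j j (ℕ.<⇒≤ j<1+k)))))

    next-rises-late : ∀ d → m (n ∸ suc k) ≤ d → suc d < m n →
                      f (suc n) (suc d) ℚ.≤ f (suc n) (suc (suc d))
    next-rises-late d m₀≤d 1+d<M = +-cancelʳ-≤ (f (n ∸ suc k) d) (begin
      f (suc n) (suc d) + f (n ∸ suc k) d
        ≡⟨ shift-identity k<n d ⟩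
      f n d + f n (suc d)
        ≤⟨ ℚ.+-mono-≤ (rises-n d (ℕ.<-trans (ℕ.n<1+n d) 1+d<M)) (rises-n (suc d) 1+d<M) ⟩
      f n (suc d) + f n (suc (suc d))
        ≡⟨ sym (shift-identity k<n (suc d)) ⟩
      f (suc n) (suc (suc d)) + f (n ∸ suc k) (suc d)
        ≤⟨ ℚ.+-monoʳ-≤ (f (suc n) (suc (suc d))) (falls-n∸k d m₀≤d) ⟩
      f (suc n) (suc (suc d)) + f (n ∸ suc k) d ∎)
      where
      open ℚ.≤-Reasoning
      rises-n : RisesBelow (f n) (m n)
      rises-n = proj₁ (modes n ℕ.≤-refl)

      falls-n∸k : FallsFrom (f (n ∸ suc k)) (m (n ∸ suc k))
      falls-n∸k = proj₂ (modes (n ∸ suc k) (n∸j≤n (suc k)))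

    next-rises : RisesBelow (f (suc n)) (m n)
    next-rises zero    _     = subst (ℚ._≤ f (suc n) 1) (sym (proj₁ rec′)) (next-nonNeg 1)
    next-rises (suc d) 1+d<M with d ℕ.<? m (n ∸ suc k)
    ... | yes d<m₀ = next-rises-early d d<m₀
    ... | no  d≮m₀ = next-rises-late d (ℕ.≮⇒≥ d≮m₀) 1+d<M

    next-falls : FallsFrom (f (suc n)) (suc (m n))
    next-falls (suc d) (s≤s M≤d) = subst₂ ℚ._≤_ (sym (proj₂ rec′ (suc d))) (sym (proj₂ rec′ d))
      (Σ₁-mono-≤ (suc k) (λ j _ →
        proj₂ (modes (n ∸ j) (n∸j≤n j)) d (ℕ.≤-trans (mode-n∸j≤mode-n j) M≤d)))

  P-next : ∀ {n} → suc k ≤ n → P f n → P f (suc n)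
  P-next {n} k<n (nonNeg∧unimodal , m , modes , bi) =
    let μ , modeN , M≤μ , μ≤1+M = rises∧falls⇒mode (next-rises k<n nonNeg modes bi)
                                                    (next-falls k<n nonNeg modes bi)
    in P-extend nonNeg (next-nonNeg k<n nonNeg modes bi) modes bi modeN M≤μ μ≤1+M
    where
    nonNeg : ∀ i → i ≤ n → NonNeg (f i)
    nonNeg i i≤n = proj₁ (nonNeg∧unimodal i i≤n)

  P-upward : P f (suc k) → ∀ {n} → suc k ≤′ n → P f n
  P-upward Pk ≤′-refl         = Pk
  P-upward Pk (≤′-step k≤′n) = P-next (ℕ.≤′⇒≤ k≤′n) (P-upward Pk k≤′n)

theorem6 : (k : ℕ) → 3 ≤ k → (f : ℕ → Coeffs) →
    (∀ n → IsPolynomial (f n)) → Recurrence k f →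
    P f k → ∀ n → k ≤ n → P f n
theorem6 (suc k) _ f _ rec Pk n 1+k≤n = P-upward rec Pk (ℕ.≤⇒≤′ 1+k≤n)
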